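{- Let $F$ be a nonsingular unsatisfiable hitting clause-set and let $F'$ be obtained from $F$ by one nfs-flip. Then $\mathrm{singind}(F')\le 1$. Moreover, if $F$ is not fs-resolvable and $\mathrm{singind}(F')=1$, and $G:=\mathrm{sNF}(F')$, then there is a nontrivial clause-factorisation $G=(G_0,C)\diamond H$ such that $\mathrm{var}(G_0)\cap\mathrm{var}(H)\ne\emptyset$.
   Context: Variables are positive integers, literals are nonzero integers, the complement of $x$ is $\overline{x}=-x$, $\mathrm{var}(x)=|x|$. A clause is a finite set of literals with no pair $x,\overline{x}$; $\bot$ is the empty clause. A clause-set is a finite set of clauses; $\mathrm{var}(F)$ is the set of variables occurring in $F$. $F$ is satisfiable if some clause meets every clause of $F$, otherwise unsatisfiable. $F$ is hitting if any two distinct clauses $C,D\in F$ have some $x\in C$ with $\overline{x}\in D$. $\mathrm{ldeg}_F(x)$ is the number of clauses containing $x$; $v\in\mathrm{var}(F)$ is singular if $\min(\mathrm{ldeg}_F(v),\mathrm{ldeg}_F(\overline v))=1$; $F$ is nonsingular if it has none. For a singular variable $v$, singular DP-reduction replaces $F$ by $\mathrm{DP}_v(F):=\{(A\cup B)\setminus\{v,\overline v\}: A,B\in F, A\cap\overline{B}=\{v\}\}\cup\{A\in F: v\notin\mathrm{var}(A)\}$. For an unsatisfiable hitting clause-set $F$, iterating singular DP-reductions until no singular variable remains always yields the same clause-set $\mathrm{sNF}(F)$ after the same number $\mathrm{singind}(F)$ of steps. An nfs-pair is $\{E\cup\{x\},E\cup\{\overline{x},y\}\}$ with $E$ a clause,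 $\mathrm{var}(x)\ne\mathrm{var}(y)$, $x,\overline x,y,\overline y\notin E$; its nfs-flip is $\{E\cup\{x,\overline y\},E\cup\{y\}\}$. An nfs-flip on $F$ replaces an nfs-pair $P\subseteq F$, neither of whose flip clauses lies in $F$, by its nfs-flip. An fs-pair is $\{E\cup\{v\},E\cup\{\overline v\}\}$ with $v,\overline v\notin E$; $F$ is fs-resolvable if it contains an fs-pair $\{E\cup\{v\},E\cup\{\overline v\}\}$ with $E\notin F$. For clause-sets $G_0,H$ and $C\in G_0$, $(G_0,C)\diamond H:=(G_0\setminus\{C\})\cup\{C\cup D: D\in H, C\cap\overline D=\emptyset\}$; this is a clause-factorisation if $\mathrm{var}(C)\cap\mathrm{var}(H)=\emptyset$, the union is disjoint, and $H$ is unsatisfiable; it is nontrivial if $G_0\ne\{\bot\}$ and $H\ne\{\bot\}$. -}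

module Defs where

open import Data.Nat using (ℕ; zero; suc; _<_)
open import Data.Integer using (ℤ; +_; -_)
open import Data.List using (List; []; _∷_; _++_)
open import Data.List.Membership.Propositional using (_∈_; _∉_)
open import Data.List.Relation.Unary.All using (All)
open import Data.Product using (Σ; ∃; ∃-syntax; _×_; _,_)
open import Data.Sum using (_⊎_)
open import Data.Empty using (⊥)
open import Relation.Nullary using (¬_)
open import Relation.Binary.PropositionalEquality using (_≡_; _≢_)

infix 3 _⟺_
_⟺_ : Set → Set → Set
A ⟺ B = (A → B) × (B → A)

-- Literals are nonzero integers, variables positive naturals (the
-- variable v ≥ 1 has literals + v and - + v).  A clause is represented
-- by a list of literals, read as the finite SET of its elements; a
-- clause-set is a list of clauses, read as the finite SET of clauses
-- (clauses compared as sets).  All notions below are invariant under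
-- this set reading.

Lit : Set
Lit = ℤ

Clause : Set
Clause = List Lit

ClauseSet : Set
ClauseSet = List Clause

_≈ᶜ_ : Clause → Clause → Set
C ≈ᶜ D = ∀ x → x ∈ C ⟺ x ∈ D

_∈ᶠ_ : Clause → ClauseSet → Set
C ∈ᶠ F = ∃[ D ] (D ∈ F × D ≈ᶜ C)

_≈ᶠ_ : ClauseSet → ClauseSet → Set
F ≈ᶠ G = ∀ C → C ∈ᶠ F ⟺ C ∈ᶠ G

WFClause : Clause → Set
WFClause C = (∀ x → x ∈ C → x ≢ + 0) × (∀ x → x ∈ C → - x ∈ C → ⊥)

WFClauseSet : ClauseSet → Set
WFClauseSet F = All WFClause F

VarC : ℕ → Clause → Set
VarC v C = (+ v ∈ C) ⊎ (- (+ v) ∈ C)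

VarF : ℕ → ClauseSet → Set
VarF v F = ∃[ C ] (C ∈ F × VarC v C)

Satisfiable : ClauseSet → Set
Satisfiable F = ∃[ T ] (WFClause T × All (λ D → ∃[ x ] (x ∈ T × x ∈ D)) F)

Unsatisfiable : ClauseSet → Set
Unsatisfiable F = ¬ Satisfiable F

Hitting : ClauseSet → Set
Hitting F = ∀ C D → C ∈ F → D ∈ F → ¬ (C ≈ᶜ D) → ∃[ x ] (x ∈ C × - x ∈ D)

Occurs : Lit → ClauseSet → Set
Occurs x F = ∃[ C ] (C ∈ F × x ∈ C)

LDegOne : Lit → ClauseSet → Set
LDegOne x F = ∃[ C ] (C ∈ F × x ∈ C × (∀ D → D ∈ F → x ∈ D → D ≈ᶜ C))

-- min(ldeg(v), ldeg(v̄)) = 1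
Singular : ClauseSet → ℕ → Set
Singular F v = 0 < v × Occurs (+ v) F × Occurs (- (+ v)) F
             × (LDegOne (+ v) F ⊎ LDegOne (- (+ v)) F)

Nonsingular : ClauseSet → Set
Nonsingular F = ∀ v → ¬ Singular F v

InDP : ClauseSet → ℕ → Clause → Set
InDP F v C =
    (∃[ A ] ∃[ B ] (A ∈ F × B ∈ F
       × (∀ x → (x ∈ A × - x ∈ B) ⟺ x ≡ + v)
       × (∀ x → x ∈ C ⟺ ((x ∈ A ⊎ x ∈ B) × x ≢ + v × x ≢ - (+ v)))))
  ⊎ (C ∈ᶠ F × ¬ VarC v C)

SDPStep : ClauseSet → ℕ → ClauseSet → Set
SDPStep F v G = Singular F v × (∀ C → C ∈ᶠ G ⟺ InDP F v C)

data SReach : ClauseSet → ℕ → ClauseSet → Set where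
  done : ∀ {F} → SReach F zero F
  step : ∀ {F F₁ G n} v → SDPStep F v F₁ → SReach F₁ n G → SReach F (suc n) G

NfsFlip : ClauseSet → ClauseSet → Set
NfsFlip F F' = ∃[ E ] ∃[ x ] ∃[ y ]
  ( WFClause E × x ≢ + 0 × y ≢ + 0
  × x ≢ y × x ≢ - y
  × x ∉ E × - x ∉ E × y ∉ E × - y ∉ E
  × (x ∷ E) ∈ᶠ F × (- x ∷ y ∷ E) ∈ᶠ F
  × ¬ ((x ∷ - y ∷ E) ∈ᶠ F) × ¬ ((y ∷ E) ∈ᶠ F)
  × (∀ C → C ∈ᶠ F' ⟺
        ((C ∈ᶠ F × ¬ (C ≈ᶜ (x ∷ E)) × ¬ (C ≈ᶜ (- x ∷ y ∷ E)))
         ⊎ C ≈ᶜ (x ∷ - y ∷ E) ⊎ C ≈ᶜ (y ∷ E))))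

FsResolvable : ClauseSet → Set
FsResolvable F = ∃[ E ] ∃[ v ]
  ( v ≢ + 0 × v ∉ E × - v ∉ E
  × (v ∷ E) ∈ᶠ F × (- v ∷ E) ∈ᶠ F × ¬ (E ∈ᶠ F))

NewPart : Clause → ClauseSet → Clause → Set
NewPart C H C' = ∃[ D ] (D ∈ H × (∀ x → x ∈ C → - x ∈ D → ⊥) × C' ≈ᶜ (C ++ D))

InDiamond : ClauseSet → Clause → ClauseSet → Clause → Set
InDiamond G₀ C H C' = (C' ∈ᶠ G₀ × ¬ (C' ≈ᶜ C)) ⊎ NewPart C H C'

NontrivialFactorisation : ClauseSet → ClauseSet → Clause → ClauseSet → Set
NontrivialFactorisation G G₀ C H =
    WFClauseSet G₀ × WFClauseSet H × C ∈ G₀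
  × (∀ v → VarC v C → VarF v H → ⊥)
  × (∀ C' → (C' ∈ᶠ G₀ × ¬ (C' ≈ᶜ C)) → NewPart C H C' → ⊥)
  × Unsatisfiable H
  × ¬ (G₀ ≈ᶠ ([] ∷ [])) × ¬ (H ≈ᶠ ([] ∷ []))
  × (∀ C' → C' ∈ᶠ G ⟺ InDiamond G₀ C H C')

-- Write P₁ = E ∪ {x}, P₂ = E ∪ {x̄, y} for the nfs-pair and
-- Q₁ = E ∪ {x, ȳ}, Q₂ = E ∪ {y} for its flip.  The flip only removes the
-- occurrence of x̄ in P₂, so a singular variable of F' must be var(x), with x̄
-- in a single clause D of F'.  Since F is unsatisfiable and hitting,
-- D ⊆ E ∪ {x̄, ȳ} and D ∖ {x̄} ⊆ K for every clause K ∋ x other than P₁: otherwise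
-- a consistent clause built from x, y, D and complemented literals satisfies F.
-- So DP on var(x) turns P₂ into Q₂, D into R = E ∪ {ȳ} (the resolvent of Q₁ and
-- D) and every other K ≠ P₁ into K ∖ {x}.  This correspondence between F ∖ {P₁}
-- and the reduct G is injective and keeps all literals except x, x̄, so G
-- inherits nonsingularity from F, which gives singind(F') ≤ 1.  Finally
-- G = (G₀ , E) ◇ {{y}, {ȳ}} with G₀ = {E} ∪ G ∖ {Q₂, R}, and y occurs in G₀
-- because it has a second occurrence in the nonsingular F.

module Submission where

open import Defs
open import Data.Nat using (ℕ; zero; suc; _≤_; z≤n; s≤s)
open import Data.Integer using (+_; -_; -[1+_]; _≟_)
open import Data.Integer.Properties using (neg-involutive; neg-injective)
open import Data.List using ([]; _∷_; _++_; [_]; map; filter)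
open import Data.List.Relation.Unary.Any using (here; there; any?)
open import Data.List.Relation.Unary.All as All using ([]; _∷_; all?)
open import Data.List.Relation.Unary.All.Properties using (¬All⇒Any¬)
open import Data.List.Membership.Propositional using (_∈_; _∉_; find; lose)
open import Data.List.Membership.Propositional.Properties
  using (∈-map⁺; ∈-map⁻; ∈-filter⁺; ∈-filter⁻; ∈-++⁺ˡ; ∈-++⁺ʳ; ∈-++⁻)
open import Data.List.Membership.DecPropositional _≟_ using (_∈?_)
open import Data.List.Relation.Binary.Subset.DecPropositional _≟_ using (_⊆_; _⊆?_)
open import Data.Product using (∃-syntax; _×_; _,_; proj₁; proj₂)
open import Data.Sum using (_⊎_; inj₁; inj₂; swap)
open import Data.Empty using (⊥; ⊥-elim)
open import Relation.Nullary using (¬_; Dec; yes; no; ¬?; _×-dec_)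
open import Relation.Nullary.Decidable using (map′; decidable-stable)
open import Relation.Binary.PropositionalEquality
  using (_≡_; _≢_; refl; sym; trans; cong; subst)

neg-swap : ∀ {a b : Lit} → - a ≡ b → a ≡ - b
neg-swap {a} p = trans (sym (neg-involutive a)) (cong -_ p)

≢-neg-self : ∀ {a : Lit} → a ≢ + 0 → a ≢ - a
≢-neg-self {+ zero}    a≢0 _  = a≢0 refl
≢-neg-self {+ suc _}   _   ()
≢-neg-self { -[1+ _ ]} _   ()

literal-of-var : (a : Lit) → a ≢ + 0 → ∃[ v ] (∀ C → a ∈ C → VarC v C)
literal-of-var (+ zero)    a≢0 = ⊥-elim (a≢0 refl)
literal-of-var (+ suc n)   _   = suc n , λ _ → inj₁
literal-of-var (-[1+ n ])  _   = suc n , λ _ → inj₂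

≈ᶜ-refl : ∀ {C} → C ≈ᶜ C
≈ᶜ-refl _ = (λ p → p) , (λ p → p)

≈ᶜ-sym : ∀ {C D} → C ≈ᶜ D → D ≈ᶜ C
≈ᶜ-sym e z = proj₂ (e z) , proj₁ (e z)

≈ᶜ-trans : ∀ {C D K} → C ≈ᶜ D → D ≈ᶜ K → C ≈ᶜ K
≈ᶜ-trans e f z = (λ p → proj₁ (f z) (proj₁ (e z) p)) , (λ p → proj₂ (e z) (proj₂ (f z) p))

to : ∀ {C D z} → C ≈ᶜ D → z ∈ C → z ∈ D
to {z = z} e = proj₁ (e z)

from : ∀ {C D z} → C ≈ᶜ D → z ∈ D → z ∈ C
from {z = z} e = proj₂ (e z)

_≈ᶜ?_ : (C D : Clause) → Dec (C ≈ᶜ D)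
C ≈ᶜ? D = map′ ⊆-antisym (λ e → to e , from e) (C ⊆? D ×-dec D ⊆? C)
  where
  ⊆-antisym : C ⊆ D × D ⊆ C → C ≈ᶜ D
  ⊆-antisym (p , q) _ = p , q

∈ᶠ-resp-≈ᶜ : ∀ {C C' F} → C ≈ᶜ C' → C ∈ᶠ F → C' ∈ᶠ F
∈ᶠ-resp-≈ᶜ e (K , k , K≈C) = K , k , ≈ᶜ-trans K≈C e

∈-∷⁻ : ∀ {a z : Lit} {C} → z ∈ a ∷ C → z ≢ a → z ∈ C
∈-∷⁻ (here z≡a) z≢a = ⊥-elim (z≢a z≡a)
∈-∷⁻ (there z∈C) _ = z∈C

∉-∷ : ∀ {a z : Lit} {C} → z ≢ a → z ∉ C → z ∉ a ∷ C
∉-∷ z≢a _ (here z≡a) = z≢a z≡a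
∉-∷ _ z∉C (there z∈C) = z∉C z∈C

∷-≈ᶜ-++ : ∀ a E → (a ∷ E) ≈ᶜ (E ++ [ a ])
∷-≈ᶜ-++ a E z = ∷⇒++ , ++⇒∷
  where
  ∷⇒++ : z ∈ a ∷ E → z ∈ E ++ [ a ]
  ∷⇒++ (here p) = ∈-++⁺ʳ E (here p)
  ∷⇒++ (there p) = ∈-++⁺ˡ p
  ++⇒∷ : z ∈ E ++ [ a ] → z ∈ a ∷ E
  ++⇒∷ m with ∈-++⁻ E m
  ... | inj₁ p = there p
  ... | inj₂ (here p) = here p

WFClause-∷ : ∀ {a T} → a ≢ + 0 → - a ∉ T → WFClause T → WFClause (a ∷ T)
WFClause-∷ {a} {T} a≢0 -a∉T (nonzero , consistent) = nonzero′ , consistent′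
  where
  nonzero′ : ∀ z → z ∈ a ∷ T → z ≢ + 0
  nonzero′ z (here refl) = a≢0
  nonzero′ z (there p) = nonzero z p
  consistent′ : ∀ z → z ∈ a ∷ T → - z ∈ a ∷ T → ⊥
  consistent′ z (here refl) (here q) = ≢-neg-self a≢0 (sym q)
  consistent′ z (here refl) (there q) = -a∉T q
  consistent′ z (there p) (here q) = -a∉T (subst (_∈ T) (neg-swap q) p)
  consistent′ z (there p) (there q) = consistent z p q

WFClause-resp : ∀ {C C'} → C ≈ᶜ C' → WFClause C → WFClause C'
WFClause-resp e (nonzero , consistent) =
  (λ z p → nonzero z (from e p)) , (λ z p q → consistent z (from e p) (from e q))

WFClause-⊆ : ∀ {C C'} → C' ⊆ C → WFClause C → WFClause C'
WFClause-⊆ sub (nonzero , consistent) =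
  (λ z p → nonzero z (sub p)) , (λ z p q → consistent z (sub p) (sub q))

negate : Clause → Clause
negate = map -_

∈-negate⁺ : ∀ {a E} → - a ∈ E → a ∈ negate E
∈-negate⁺ {a} p = subst (_∈ _) (neg-involutive a) (∈-map⁺ -_ p)

∈-negate⁻ : ∀ {a E} → a ∈ negate E → - a ∈ E
∈-negate⁻ m with ∈-map⁻ -_ m
... | e , e∈E , refl = subst (_∈ _) (sym (neg-involutive e)) e∈E

∉-negate : ∀ {a E} → a ∉ E → - a ∉ negate E
∉-negate {a} a∉E m = a∉E (subst (_∈ _) (neg-involutive a) (∈-negate⁻ m))

WFClause-negate : ∀ {E} → WFClause E → WFClause (negate E)
WFClause-negate (nonzero , consistent) =
    (λ z p z≡0 → nonzero (- z) (∈-negate⁻ p) (cong -_ z≡0))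
  , (λ z p q → consistent (- z) (∈-negate⁻ p) (∈-negate⁻ q))

delete : Lit → Clause → Clause
delete a = filter (λ z → ¬? (z ≟ a))

∈-delete⁺ : ∀ {a z C} → z ∈ C → z ≢ a → z ∈ delete a C
∈-delete⁺ = ∈-filter⁺ (λ z → ¬? (z ≟ _))

∈-delete⁻ : ∀ {a z C} → z ∈ delete a C → z ∈ C × z ≢ a
∈-delete⁻ = ∈-filter⁻ (λ z → ¬? (z ≟ _))

delete-absent : ∀ {a C} → a ∉ C → delete a C ≈ᶜ C
delete-absent a∉C z = (λ m → proj₁ (∈-delete⁻ m))
                    , (λ m → ∈-delete⁺ m (λ { refl → a∉C m }))

Falsified : ClauseSet → Clause → Set
Falsified F T = ∃[ K ] (K ∈ F × (∀ l → l ∈ T → l ∉ K))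

falsified-clause : ∀ {F T} → Unsatisfiable F → WFClause T → Falsified F T
falsified-clause {F} {T} unsat wf-T with all? (λ K → any? (_∈? K) T) F
... | yes meets = ⊥-elim (unsat (T , wf-T , All.map find meets))
... | no ¬meets with find (¬All⇒Any¬ (λ K → any? (_∈? K) T) F ¬meets)
...   | K , k , misses = K , k , λ l l∈T l∈K → misses (lose l∈T l∈K)

occurs-∈ᶠ : ∀ {F C l} → C ∈ᶠ F → l ∈ C → Occurs l F
occurs-∈ᶠ (K , K∈F , K≈C) l∈C = K , K∈F , from K≈C l∈C

Hitting-∈ᶠ : ∀ {F K C} → Hitting F → K ∈ F → C ∈ᶠ F → ¬ K ≈ᶜ C → ∃[ l ] (l ∈ K × - l ∈ C)
Hitting-∈ᶠ {K = K} hit K∈F (C' , C'∈F , C'≈C) K≉C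
  with hit K C' K∈F C'∈F (λ K≈C' → K≉C (≈ᶜ-trans K≈C' C'≈C))
... | l , l∈K , -l∈C' = l , l∈K , to C'≈C -l∈C'

≉-[[]] : ∀ {G C l} → C ∈ G → l ∈ C → ¬ G ≈ᶠ ([] ∷ [])
≉-[[]] {C = C} C∈G l∈C G≈⊥ with proj₁ (G≈⊥ C) (C , C∈G , ≈ᶜ-refl)
... | [] , here refl , []≈C with from []≈C l∈C
...   | ()

VarC-[]-disjoint : ∀ {a v E} → a ∉ E → - a ∉ E → VarC v [ a ] → ¬ VarC v E
VarC-[]-disjoint a∉E _    (inj₁ (here refl)) (inj₁ m) = a∉E m
VarC-[]-disjoint _   -a∉E (inj₁ (here refl)) (inj₂ m) = -a∉E m
VarC-[]-disjoint _   -a∉E (inj₂ (here refl)) (inj₁ m) =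
  -a∉E (subst (_∈ _) (sym (neg-involutive _)) m)
VarC-[]-disjoint a∉E _    (inj₂ (here refl)) (inj₂ m) = a∉E m

-- Resolution, oriented by the resolved literal

Resolvent : Lit → Clause → Clause → Clause → Set
Resolvent a A B C = (∀ z → (z ∈ A × - z ∈ B) ⟺ z ≡ a)
                  × (∀ z → z ∈ C ⟺ ((z ∈ A ⊎ z ∈ B) × z ≢ a × z ≢ - a))

InDPˡ : ClauseSet → Lit → Clause → Set
InDPˡ F a C = (∃[ A ] ∃[ B ] (A ∈ F × B ∈ F × Resolvent a A B C))
            ⊎ (C ∈ᶠ F × a ∉ C × - a ∉ C)

Resolvent-pivot : ∀ {a A B C} → Resolvent a A B C → a ∈ A × - a ∈ B
Resolvent-pivot (clash , _) = proj₂ (clash _) refl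

Resolvent-unique : ∀ {a A B C C'} → Resolvent a A B C → Resolvent a A B C' → C ≈ᶜ C'
Resolvent-unique (_ , mem) (_ , mem′) z =
  (λ m → proj₂ (mem′ z) (proj₁ (mem z) m)) , (λ m → proj₂ (mem z) (proj₁ (mem′ z) m))

Resolvent-resp : ∀ {a A A' B B' C} → A ≈ᶜ A' → B ≈ᶜ B'
               → Resolvent a A B C → Resolvent a A' B' C
Resolvent-resp {a} {A} {A'} {B} {B'} eA eB (clash , mem) = clash′ , mem′
  where
  clash′ : ∀ z → (z ∈ A' × - z ∈ B') ⟺ z ≡ a
  clash′ z = (λ (p , q) → proj₁ (clash z) (from eA p , from eB q))
           , (λ e → let (p , q) = proj₂ (clash z) e in to eA p , to eB q)
  ∈A⊎B : ∀ {z} → z ∈ A ⊎ z ∈ B → z ∈ A' ⊎ z ∈ B'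
  ∈A⊎B (inj₁ p) = inj₁ (to eA p)
  ∈A⊎B (inj₂ q) = inj₂ (to eB q)
  ∈A'⊎B' : ∀ {z} → z ∈ A' ⊎ z ∈ B' → z ∈ A ⊎ z ∈ B
  ∈A'⊎B' (inj₁ p) = inj₁ (from eA p)
  ∈A'⊎B' (inj₂ q) = inj₂ (from eB q)
  mem′ : ∀ z → z ∈ _ ⟺ ((z ∈ A' ⊎ z ∈ B') × z ≢ a × z ≢ - a)
  mem′ z = (λ m → let (p , n₁ , n₂) = proj₁ (mem z) m in ∈A⊎B p , n₁ , n₂)
         , (λ (p , n₁ , n₂) → proj₂ (mem z) (∈A'⊎B' p , n₁ , n₂))

Resolvent-swap : ∀ {a A B C} → Resolvent a A B C → Resolvent (- a) B A C
Resolvent-swap {a} {A} {B} (clash , mem) = clash′ , mem′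
  where
  clash′ : ∀ z → (z ∈ B × - z ∈ A) ⟺ z ≡ - a
  clash′ z = (λ (p , q) → neg-swap (proj₁ (clash (- z))
                             (q , subst (_∈ B) (sym (neg-involutive z)) p)))
           , (λ { refl → let (p , q) = proj₂ (clash a) refl
                         in q , subst (_∈ A) (sym (neg-involutive a)) p })
  mem′ : ∀ z → z ∈ _ ⟺ ((z ∈ B ⊎ z ∈ A) × z ≢ - a × z ≢ - - a)
  mem′ z = (λ m → let (p , n₁ , n₂) = proj₁ (mem z) m
                  in swap p , n₂ , (λ e → n₁ (trans e (neg-involutive a))))
         , (λ (p , n₁ , n₂) → proj₂ (mem z)
                  (swap p , (λ e → n₂ (trans e (sym (neg-involutive a)))) , n₁))

InDPˡ-neg : ∀ {F a C} → InDPˡ F a C → InDPˡ F (- a) C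
InDPˡ-neg (inj₁ (A , B , a , b , res)) = inj₁ (B , A , b , a , Resolvent-swap res)
InDPˡ-neg {a = a} {C} (inj₂ (c , a∉C , -a∉C)) =
  inj₂ (c , -a∉C , λ m → a∉C (subst (_∈ C) (neg-involutive a) m))

InDP⇔InDPˡ : ∀ {F v a C} → (a ≡ + v ⊎ a ≡ - (+ v)) → InDP F v C ⟺ InDPˡ F a C
InDP⇔InDPˡ {F} {v} {C = C} (inj₁ refl) = positive , negative
  where
  positive : InDP F v C → InDPˡ F (+ v) C
  positive (inj₁ res) = inj₁ res
  positive (inj₂ (c , ¬var)) = inj₂ (c , (λ m → ¬var (inj₁ m)) , (λ m → ¬var (inj₂ m)))
  negative : InDPˡ F (+ v) C → InDP F v C
  negative (inj₁ res) = inj₁ res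
  negative (inj₂ (c , v∉C , -v∉C)) = inj₂ (c , λ { (inj₁ m) → v∉C m ; (inj₂ m) → -v∉C m })
InDP⇔InDPˡ {F} {v} {C = C} (inj₂ refl) =
    (λ d → InDPˡ-neg (proj₁ (InDP⇔InDPˡ (inj₁ refl)) d))
  , (λ d → proj₂ (InDP⇔InDPˡ (inj₁ refl))
             (subst (λ a → InDPˡ F a C) (neg-involutive (+ v)) (InDPˡ-neg d)))

InDPˡ-free : ∀ {F a C} → InDPˡ F a C → a ∉ C × - a ∉ C
InDPˡ-free (inj₁ (_ , _ , _ , _ , _ , mem)) =
  (λ m → proj₁ (proj₂ (proj₁ (mem _) m)) refl) , (λ m → proj₂ (proj₂ (proj₁ (mem _) m)) refl)
InDPˡ-free (inj₂ (_ , a∉C , -a∉C)) = a∉C , -a∉C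

∷-clash : ∀ {a z R} → WFClause R → z ∈ a ∷ R → - z ∈ - a ∷ R → z ≡ a
∷-clash _ (here z≡a) _ = z≡a
∷-clash _ (there _) (here -z≡-a) = neg-injective -z≡-a
∷-clash (_ , consistent) (there z∈R) (there -z∈R) = ⊥-elim (consistent _ z∈R -z∈R)

delete-injective : ∀ {F a A B} → WFClauseSet F → Hitting F → A ∈ F → B ∈ F → - a ∉ B
                 → delete a A ≈ᶜ delete a B → A ≈ᶜ B
delete-injective {a = a} {A} {B} wf hit A∈F B∈F -a∉B e with A ≈ᶜ? B
... | yes A≈B = A≈B
... | no A≉B with hit A B A∈F B∈F A≉B
...   | l , l∈A , -l∈B with l ≟ a
...     | yes refl = ⊥-elim (-a∉B -l∈B)
...     | no l≢a = ⊥-elim (proj₂ (All.lookup wf B∈F) l l∈B -l∈B)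
  where
  l∈B = proj₁ (∈-delete⁻ (to e (∈-delete⁺ l∈A l≢a)))

-- Literal degrees

LDegOne-unique : ∀ {a G A B} → LDegOne a G → A ∈ᶠ G → B ∈ᶠ G → a ∈ A → a ∈ B → A ≈ᶜ B
LDegOne-unique (K , _ , _ , unique) (A' , A'∈G , A'≈A) (B' , B'∈G , B'≈B) a∈A a∈B =
  ≈ᶜ-trans A≈K (≈ᶜ-sym B≈K)
  where
  A≈K = ≈ᶜ-trans (≈ᶜ-sym A'≈A) (unique A' A'∈G (from A'≈A a∈A))
  B≈K = ≈ᶜ-trans (≈ᶜ-sym B'≈B) (unique B' B'∈G (from B'≈B a∈B))

LDegOne-reflect : ∀ {F G a} (R : Clause → Clause → Set)
  → (∀ {K} → K ∈ F → a ∈ K → ∃[ C ] (C ∈ᶠ G × a ∈ C × R K C))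
  → (∀ {K K' C C'} → K ∈ F → K' ∈ F → R K C → R K' C' → C ≈ᶜ C' → K ≈ᶜ K')
  → Occurs a F → LDegOne a G → LDegOne a F
LDegOne-reflect {F} {a = a} R image injective (K₀ , K₀∈F , a∈K₀) ld = K₀ , K₀∈F , a∈K₀ , unique
  where
  unique : ∀ K → K ∈ F → a ∈ K → K ≈ᶜ K₀
  unique K K∈F a∈K with image K∈F a∈K | image K₀∈F a∈K₀
  ... | C , C∈G , a∈C , r | C₀ , C₀∈G , a∈C₀ , r₀ =
    injective K∈F K₀∈F r r₀ (LDegOne-unique ld C∈G C₀∈G a∈C a∈C₀)

¬LDegOne : ∀ {F a} → Nonsingular F → a ≢ + 0 → Occurs a F → Occurs (- a) F → ¬ LDegOne a F
¬LDegOne {a = + zero}    _       a≢0 _ _ _ = a≢0 refl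
¬LDegOne {a = + suc n}   nonsing _ o⁺ o⁻ ld = nonsing (suc n) (s≤s z≤n , o⁺ , o⁻ , inj₁ ld)
¬LDegOne {a = -[1+ n ]}  nonsing _ o⁻ o⁺ ld = nonsing (suc n) (s≤s z≤n , o⁺ , o⁻ , inj₂ ld)

another-occurrence : ∀ {F a K} → Nonsingular F → a ≢ + 0 → Occurs (- a) F → K ∈ F → a ∈ K
                   → ∃[ K' ] (K' ∈ F × a ∈ K' × ¬ K' ≈ᶜ K)
another-occurrence {F} {a} {K} nonsing a≢0 o⁻ K∈F a∈K
  with any? (λ K' → (a ∈? K') ×-dec ¬? (K' ≈ᶜ? K)) F
... | yes some = let (K' , K'∈F , a∈K' , K'≉K) = find some in K' , K'∈F , a∈K' , K'≉K
... | no none = ⊥-elim (¬LDegOne nonsing a≢0 (K , K∈F , a∈K) o⁻ (K , K∈F , a∈K , only-K))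
  where
  only-K : ∀ K' → K' ∈ F → a ∈ K' → K' ≈ᶜ K
  only-K K' K'∈F a∈K' with K' ≈ᶜ? K
  ... | yes e = e
  ... | no K'≉K = ⊥-elim (none (lose K'∈F (a∈K' , K'≉K)))

Nonsingular-reflect : ∀ {F G} → (∀ {l} → Occurs l G → Occurs l F)
                    → (∀ {l} → LDegOne l G → LDegOne l F) → Nonsingular F → Nonsingular G
Nonsingular-reflect occ ld nonsing v (v>0 , o⁺ , o⁻ , inj₁ d) = nonsing v (v>0 , occ o⁺ , occ o⁻ , inj₁ (ld d))
Nonsingular-reflect occ ld nonsing v (v>0 , o⁺ , o⁻ , inj₂ d) = nonsing v (v>0 , occ o⁺ , occ o⁻ , inj₂ (ld d))

module Flip
  {F F' : ClauseSet} (wf-F : WFClauseSet F) (unsat : Unsatisfiable F) (hit : Hitting F)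
  (nonsing : Nonsingular F)
  (E : Clause) (x y : Lit) (wf-E : WFClause E) (x≢0 : x ≢ + 0) (y≢0 : y ≢ + 0)
  (x≢y : x ≢ y) (x≢-y : x ≢ - y) (x∉E : x ∉ E) (-x∉E : - x ∉ E) (y∉E : y ∉ E) (-y∉E : - y ∉ E)
  (P₁∈F : (x ∷ E) ∈ᶠ F) (P₂∈F : (- x ∷ y ∷ E) ∈ᶠ F)
  (Q₁∉F : ¬ ((x ∷ - y ∷ E) ∈ᶠ F)) (Q₂∉F : ¬ ((y ∷ E) ∈ᶠ F))
  (F'-def : ∀ C → C ∈ᶠ F' ⟺
     ((C ∈ᶠ F × ¬ (C ≈ᶜ (x ∷ E)) × ¬ (C ≈ᶜ (- x ∷ y ∷ E)))
      ⊎ C ≈ᶜ (x ∷ - y ∷ E) ⊎ C ≈ᶜ (y ∷ E)))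
  where

  -- R will be the resolvent of Q₁ = x ∷ R with the unique clause of F' containing x̄.
  P₁ P₂ Q₁ Q₂ R : Clause
  P₁ = x ∷ E
  P₂ = - x ∷ y ∷ E
  Q₁ = x ∷ - y ∷ E
  Q₂ = y ∷ E
  R = - y ∷ E

  wf : ∀ {K} → K ∈ F → WFClause K
  wf = All.lookup wf-F

  -x≢x : - x ≢ x
  -x≢x p = ≢-neg-self x≢0 (sym p)

  -x≢y : - x ≢ y
  -x≢y p = x≢-y (neg-swap p)

  -x≢-y : - x ≢ - y
  -x≢-y p = x≢y (neg-injective p)

  x∉R : x ∉ R
  x∉R = ∉-∷ x≢-y x∉E

  -x∉R : - x ∉ R
  -x∉R = ∉-∷ -x≢-y -x∉E

  -x∉P₁ : - x ∉ P₁
  -x∉P₁ = ∉-∷ -x≢x -x∉E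

  x∉Q₂ : x ∉ Q₂
  x∉Q₂ = ∉-∷ x≢y x∉E

  -x∉Q₂ : - x ∉ Q₂
  -x∉Q₂ = ∉-∷ -x≢y -x∉E

  wf-Q₂ : WFClause Q₂
  wf-Q₂ = WFClause-∷ y≢0 -y∉E wf-E

  wf-R : WFClause R
  wf-R = WFClause-∷ (λ p → y≢0 (neg-swap p)) (λ m → y∉E (subst (_∈ E) (neg-involutive y) m)) wf-E

  Q₁≉Q₂ : ¬ Q₁ ≈ᶜ Q₂
  Q₁≉Q₂ e = ∉-∷ x≢y x∉E (to e (here refl))

  Q₂≉R : ¬ Q₂ ≈ᶜ R
  Q₂≉R e = ∉-∷ (≢-neg-self y≢0) y∉E (to e (here refl))

  F'-cases : ∀ {K} → K ∈ F' → (K ∈ᶠ F × ¬ K ≈ᶜ P₁ × ¬ K ≈ᶜ P₂) ⊎ K ≈ᶜ Q₁ ⊎ K ≈ᶜ Q₂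
  F'-cases {K} K∈F' = proj₁ (F'-def K) (K , K∈F' , ≈ᶜ-refl)

  F'-keeps : ∀ {K} → K ∈ F → ¬ K ≈ᶜ P₁ → ¬ K ≈ᶜ P₂ → K ∈ᶠ F'
  F'-keeps {K} K∈F K≉P₁ K≉P₂ = proj₂ (F'-def K) (inj₁ ((K , K∈F , ≈ᶜ-refl) , K≉P₁ , K≉P₂))

  Q₁∈F' : Q₁ ∈ᶠ F'
  Q₁∈F' = proj₂ (F'-def Q₁) (inj₂ (inj₁ ≈ᶜ-refl))

  Q₂∈F' : Q₂ ∈ᶠ F'
  Q₂∈F' = proj₂ (F'-def Q₂) (inj₂ (inj₂ ≈ᶜ-refl))

  neg-E≢x : ∀ {e} → e ∈ E → - e ≢ x
  neg-E≢x e∈E -e≡x = -x∉E (subst (_∈ E) (neg-swap -e≡x) e∈E)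

  clashes-with-E : ∀ {K} → K ∈ F → ¬ K ≈ᶜ P₁ → - x ∉ K → ∃[ e ] (e ∈ E × - e ∈ K)
  clashes-with-E {K} K∈F K≉P₁ -x∉K with Hitting-∈ᶠ hit K∈F P₁∈F K≉P₁
  ... | l , l∈K , here -l≡x = ⊥-elim (-x∉K (subst (_∈ K) (neg-swap -l≡x) l∈K))
  ... | l , l∈K , there -l∈E = - l , -l∈E , subst (_∈ K) (sym (neg-involutive l)) l∈K

  -- delete x K contains the complement of a literal of E.
  delete≉⊇E : ∀ {K C} → K ∈ F → - x ∉ K → ¬ K ≈ᶜ P₁ → WFClause C → E ⊆ C
            → ¬ delete x K ≈ᶜ C
  delete≉⊇E K∈F -x∉K K≉P₁ wf-C E⊆C e with clashes-with-E K∈F K≉P₁ -x∉K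
  ... | c , c∈E , -c∈K = proj₂ wf-C c (E⊆C c∈E) (to e (∈-delete⁺ -c∈K (neg-E≢x c∈E)))

  -- Otherwise the consistent clause y ∷ x ∷ Ē would satisfy F.
  -y-occurs : Occurs (- y) F
  -y-occurs = falsified (falsified-clause unsat wf-T)
    where
    T = y ∷ x ∷ negate E
    wf-T : WFClause T
    wf-T = WFClause-∷ y≢0 (∉-∷ (λ p → x≢-y (sym p)) (∉-negate y∉E))
             (WFClause-∷ x≢0 (∉-negate x∉E) (WFClause-negate wf-E))
    falsified : Falsified F T → Occurs (- y) F
    falsified (K , K∈F , misses) with K ≈ᶜ? P₂
    ... | yes K≈P₂ = ⊥-elim (misses y (here refl) (from K≈P₂ (there (here refl))))
    ... | no K≉P₂ with Hitting-∈ᶠ hit K∈F P₂∈F K≉P₂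
    ...   | l , l∈K , here -l≡-x =
            ⊥-elim (misses x (there (here refl)) (subst (_∈ K) (neg-injective -l≡-x) l∈K))
    ...   | l , l∈K , there (here -l≡y) = K , K∈F , subst (_∈ K) (neg-swap -l≡y) l∈K
    ...   | l , l∈K , there (there -l∈E) =
            ⊥-elim (misses l (there (there (∈-negate⁺ -l∈E))) l∈K)

  Occurs-F'⇒F : ∀ {l} → Occurs l F' → Occurs l F
  Occurs-F'⇒F (K , K∈F' , l∈K) with F'-cases K∈F'
  ... | inj₁ (K∈F , _) = occurs-∈ᶠ K∈F l∈K
  ... | inj₂ (inj₂ K≈Q₂) = occurs-∈ᶠ P₂∈F (there (to K≈Q₂ l∈K))
  ... | inj₂ (inj₁ K≈Q₁) with to K≈Q₁ l∈K
  ...   | here refl = occurs-∈ᶠ P₁∈F (here refl)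
  ...   | there (here refl) = -y-occurs
  ...   | there (there l∈E) = occurs-∈ᶠ P₁∈F (there l∈E)

  Flipped : Clause → Clause → Set
  Flipped K C = (K ≈ᶜ P₁ × C ≈ᶜ Q₁) ⊎ (K ≈ᶜ P₂ × C ≈ᶜ Q₂) ⊎ (¬ K ≈ᶜ P₁ × ¬ K ≈ᶜ P₂ × C ≈ᶜ K)

  flip-image : ∀ {K} → K ∈ F → ∃[ C ] (C ∈ᶠ F' × Flipped K C)
  flip-image {K} K∈F with K ≈ᶜ? P₁ | K ≈ᶜ? P₂
  ... | yes K≈P₁ | _ = Q₁ , Q₁∈F' , inj₁ (K≈P₁ , ≈ᶜ-refl)
  ... | no _ | yes K≈P₂ = Q₂ , Q₂∈F' , inj₂ (inj₁ (K≈P₂ , ≈ᶜ-refl))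
  ... | no K≉P₁ | no K≉P₂ = K , F'-keeps K∈F K≉P₁ K≉P₂ , inj₂ (inj₂ (K≉P₁ , K≉P₂ , ≈ᶜ-refl))

  flip-preserves : ∀ {K C l} → Flipped K C → l ∈ K → l ≢ - x → l ∈ C
  flip-preserves (inj₁ (K≈P₁ , C≈Q₁)) l∈K _ with to K≈P₁ l∈K
  ... | here l≡x = from C≈Q₁ (here l≡x)
  ... | there l∈E = from C≈Q₁ (there (there l∈E))
  flip-preserves (inj₂ (inj₁ (K≈P₂ , C≈Q₂))) l∈K l≢-x = from C≈Q₂ (∈-∷⁻ (to K≈P₂ l∈K) l≢-x)
  flip-preserves (inj₂ (inj₂ (_ , _ , C≈K))) l∈K _ = from C≈K l∈K

  flip-injective : ∀ {K K' C C'} → K ∈ F → K' ∈ F → Flipped K C → Flipped K' C' → C ≈ᶜ C'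
                 → K ≈ᶜ K'
  flip-injective _ _ (inj₁ (K≈P₁ , _)) (inj₁ (K'≈P₁ , _)) _ = ≈ᶜ-trans K≈P₁ (≈ᶜ-sym K'≈P₁)
  flip-injective _ _ (inj₂ (inj₁ (K≈P₂ , _))) (inj₂ (inj₁ (K'≈P₂ , _))) _ =
    ≈ᶜ-trans K≈P₂ (≈ᶜ-sym K'≈P₂)
  flip-injective _ _ (inj₂ (inj₂ (_ , _ , C≈K))) (inj₂ (inj₂ (_ , _ , C'≈K'))) e =
    ≈ᶜ-trans (≈ᶜ-sym C≈K) (≈ᶜ-trans e C'≈K')
  flip-injective _ _ (inj₁ (_ , C≈Q₁)) (inj₂ (inj₁ (_ , C'≈Q₂))) e =
    ⊥-elim (Q₁≉Q₂ (≈ᶜ-trans (≈ᶜ-sym C≈Q₁) (≈ᶜ-trans e C'≈Q₂)))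
  flip-injective _ _ (inj₂ (inj₁ (_ , C≈Q₂))) (inj₁ (_ , C'≈Q₁)) e =
    ⊥-elim (Q₁≉Q₂ (≈ᶜ-trans (≈ᶜ-sym C'≈Q₁) (≈ᶜ-trans (≈ᶜ-sym e) C≈Q₂)))
  flip-injective _ K'∈F (inj₁ (_ , C≈Q₁)) (inj₂ (inj₂ (_ , _ , C'≈K'))) e =
    ⊥-elim (Q₁∉F (_ , K'∈F , ≈ᶜ-trans (≈ᶜ-sym C'≈K') (≈ᶜ-trans (≈ᶜ-sym e) C≈Q₁)))
  flip-injective K∈F _ (inj₂ (inj₂ (_ , _ , C≈K))) (inj₁ (_ , C'≈Q₁)) e =
    ⊥-elim (Q₁∉F (_ , K∈F , ≈ᶜ-trans (≈ᶜ-sym C≈K) (≈ᶜ-trans e C'≈Q₁)))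
  flip-injective _ K'∈F (inj₂ (inj₁ (_ , C≈Q₂))) (inj₂ (inj₂ (_ , _ , C'≈K'))) e =
    ⊥-elim (Q₂∉F (_ , K'∈F , ≈ᶜ-trans (≈ᶜ-sym C'≈K') (≈ᶜ-trans (≈ᶜ-sym e) C≈Q₂)))
  flip-injective K∈F _ (inj₂ (inj₂ (_ , _ , C≈K))) (inj₂ (inj₁ (_ , C'≈Q₂))) e =
    ⊥-elim (Q₂∉F (_ , K∈F , ≈ᶜ-trans (≈ᶜ-sym C≈K) (≈ᶜ-trans e C'≈Q₂)))

  LDegOne-F'⇒F : ∀ {l} → LDegOne l F' → l ≢ - x → LDegOne l F
  LDegOne-F'⇒F {l} ld@(K , K∈F' , l∈K , _) l≢-x =
    LDegOne-reflect Flipped image flip-injective (Occurs-F'⇒F (K , K∈F' , l∈K)) ld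
    where
    image : ∀ {K} → K ∈ F → l ∈ K → ∃[ C ] (C ∈ᶠ F' × l ∈ C × Flipped K C)
    image K∈F l∈K = let (C , C∈F' , f) = flip-image K∈F in C , C∈F' , flip-preserves f l∈K l≢-x , f

  -- Only x̄ can lose its second occurrence, so var(x) is the only singular variable of F'.
  singular-F' : ∀ {v} → Singular F' v → (x ≡ + v ⊎ x ≡ - (+ v)) × LDegOne (- x) F'
  singular-F' {v} (v>0 , o⁺ , o⁻ , inj₁ ld) with + v ≟ - x
  ... | yes v≡-x = inj₂ (neg-swap (sym v≡-x)) , subst (λ a → LDegOne a F') v≡-x ld
  ... | no v≢-x =
    ⊥-elim (nonsing v (v>0 , Occurs-F'⇒F o⁺ , Occurs-F'⇒F o⁻ , inj₁ (LDegOne-F'⇒F ld v≢-x)))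
  singular-F' {v} (v>0 , o⁺ , o⁻ , inj₂ ld) with - (+ v) ≟ - x
  ... | yes -v≡-x = inj₁ (sym (neg-injective -v≡-x)) , subst (λ a → LDegOne a F') -v≡-x ld
  ... | no -v≢-x =
    ⊥-elim (nonsing v (v>0 , Occurs-F'⇒F o⁺ , Occurs-F'⇒F o⁻ , inj₂ (LDegOne-F'⇒F ld -v≢-x)))

  module Pivot (D : Clause) (D∈F' : D ∈ F') (-x∈D : - x ∈ D)
               (D-unique : ∀ K → K ∈ F' → - x ∈ K → K ≈ᶜ D) where

    D∈ᶠF : D ∈ᶠ F
    D∈ᶠF with F'-cases D∈F'
    ... | inj₁ (D∈ᶠF , _) = D∈ᶠF
    ... | inj₂ (inj₁ D≈Q₁) = ⊥-elim (∉-∷ -x≢x -x∉R (to D≈Q₁ -x∈D))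
    ... | inj₂ (inj₂ D≈Q₂) = ⊥-elim (-x∉Q₂ (to D≈Q₂ -x∈D))

    wf-D : WFClause D
    wf-D = let (D' , D'∈F , D'≈D) = D∈ᶠF in WFClause-resp D'≈D (wf D'∈F)

    x̄-clauses : ∀ {K} → K ∈ F → - x ∈ K → K ≈ᶜ P₂ ⊎ K ≈ᶜ D
    x̄-clauses {K} K∈F -x∈K with K ≈ᶜ? P₂
    ... | yes K≈P₂ = inj₁ K≈P₂
    ... | no K≉P₂ with F'-keeps K∈F (λ K≈P₁ → -x∉P₁ (to K≈P₁ -x∈K)) K≉P₂
    ...   | K' , K'∈F' , K'≈K =
            inj₂ (≈ᶜ-trans (≈ᶜ-sym K'≈K) (D-unique K' K'∈F' (from K'≈K -x∈K)))

    -- Otherwise the consistent clause x ∷ y ∷ z ∷ Ē would satisfy F.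
    D⊆x̄∷R : ∀ {z} → z ∈ D → z ∈ - x ∷ R
    D⊆x̄∷R {z} z∈D = decidable-stable (z ∈? - x ∷ R) λ z∉ → falsified (falsified-clause unsat (wf-T z∉))
      where
      T = x ∷ y ∷ z ∷ negate E
      wf-T : z ∉ - x ∷ R → WFClause T
      wf-T z∉ =
        WFClause-∷ x≢0 (∉-∷ -x≢y (∉-∷ (λ p → z∉ (here (sym p))) (∉-negate x∉E)))
          (WFClause-∷ y≢0 (∉-∷ (λ p → z∉ (there (here (sym p)))) (∉-negate y∉E))
            (WFClause-∷ (proj₁ wf-D z z∈D) (∉-negate (λ z∈E → z∉ (there (there z∈E))))
              (WFClause-negate wf-E)))
      falsified : Falsified F T → ⊥
      falsified (K , K∈F , misses) with - x ∈? K
      ... | yes -x∈K with x̄-clauses K∈F -x∈K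
      ...   | inj₁ K≈P₂ = misses y (there (here refl)) (from K≈P₂ (there (here refl)))
      ...   | inj₂ K≈D = misses z (there (there (here refl))) (from K≈D z∈D)
      falsified (K , K∈F , misses) | no -x∉K
        with clashes-with-E K∈F (λ K≈P₁ → misses x (here refl) (from K≈P₁ (here refl))) -x∉K
      ... | e , e∈E , -e∈K = misses (- e) (there (there (there (∈-map⁺ -_ e∈E)))) -e∈K

    -- Otherwise the consistent clause x ∷ z ∷ (B ∖ x)‾ would satisfy F.
    D-absorbed : ∀ {B z} → B ∈ F → x ∈ B → ¬ B ≈ᶜ P₁ → z ∈ D → z ≢ - x → z ∈ B
    D-absorbed {B} {z} B∈F x∈B B≉P₁ z∈D z≢-x =
      decidable-stable (z ∈? B) λ z∉B → falsified (falsified-clause unsat (wf-T z∉B))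
      where
      T = x ∷ z ∷ negate (delete x B)
      -x∉B : - x ∉ B
      -x∉B = proj₂ (wf B∈F) x x∈B
      wf-T : z ∉ B → WFClause T
      wf-T z∉B =
        WFClause-∷ x≢0 (∉-∷ (λ p → z≢-x (sym p)) (∉-negate (λ m → proj₂ (∈-delete⁻ {C = B} m) refl)))
          (WFClause-∷ (proj₁ wf-D z z∈D) (∉-negate (λ m → z∉B (proj₁ (∈-delete⁻ m))))
            (WFClause-negate (WFClause-⊆ (λ m → proj₁ (∈-delete⁻ m)) (wf B∈F))))
      negated : ∀ {l} → - l ∈ B → - l ≢ x → l ∈ T
      negated -l∈B -l≢x = there (there (∈-negate⁺ (∈-delete⁺ -l∈B -l≢x)))
      falsified : Falsified F T → ⊥
      falsified (K , K∈F , misses) with - x ∈? K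
      ... | yes -x∈K with x̄-clauses K∈F -x∈K
      ...   | inj₂ K≈D = misses z (there (here refl)) (from K≈D z∈D)
      ...   | inj₁ K≈P₂ with clashes-with-E B∈F B≉P₁ -x∉B
      ...     | e , e∈E , -e∈B = misses e (negated -e∈B (neg-E≢x e∈E)) (from K≈P₂ (there (there e∈E)))
      falsified (K , K∈F , misses) | no -x∉K
        with hit K B K∈F B∈F (λ K≈B → misses x (here refl) (from K≈B x∈B))
      ... | l , l∈K , -l∈B with - l ≟ x
      ...   | yes -l≡x = -x∉K (subst (_∈ K) (neg-swap -l≡x) l∈K)
      ...   | no -l≢x = misses l (negated -l∈B -l≢x) l∈K

    resolvent-Q₁ : Resolvent x Q₁ D R
    resolvent-Q₁ = clash , members
      where
      clash : ∀ z → (z ∈ Q₁ × - z ∈ D) ⟺ z ≡ x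
      clash z = (λ (z∈Q₁ , -z∈D) → ∷-clash wf-R z∈Q₁ (D⊆x̄∷R -z∈D))
              , λ { refl → here refl , -x∈D }
      members : ∀ z → z ∈ R ⟺ ((z ∈ Q₁ ⊎ z ∈ D) × z ≢ x × z ≢ - x)
      members z = (λ z∈R → inj₁ (there z∈R) , (λ { refl → x∉R z∈R }) , (λ { refl → -x∉R z∈R }))
                , λ { (inj₁ z∈Q₁ , z≢x , _) → ∈-∷⁻ z∈Q₁ z≢x
                    ; (inj₂ z∈D , _ , z≢-x) → ∈-∷⁻ (D⊆x̄∷R z∈D) z≢-x }

    resolvent-delete : ∀ {K} → K ∈ F → x ∈ K → ¬ K ≈ᶜ P₁ → Resolvent x K D (delete x K)
    resolvent-delete {K} K∈F x∈K K≉P₁ = clash , members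
      where
      absorbed : ∀ {z} → z ∈ D → z ≢ - x → z ∈ K
      absorbed = D-absorbed K∈F x∈K K≉P₁
      clash : ∀ z → (z ∈ K × - z ∈ D) ⟺ z ≡ x
      clash z = (λ (z∈K , -z∈D) → decidable-stable (z ≟ x) λ z≢x →
                   proj₂ (wf K∈F) z z∈K (absorbed -z∈D (λ p → z≢x (neg-injective p))))
              , λ { refl → x∈K , -x∈D }
      members : ∀ z → z ∈ delete x K ⟺ ((z ∈ K ⊎ z ∈ D) × z ≢ x × z ≢ - x)
      members z = (λ m → let (z∈K , z≢x) = ∈-delete⁻ m
                         in inj₁ z∈K , z≢x , (λ { refl → proj₂ (wf K∈F) x x∈K z∈K }))
                , λ { (inj₁ z∈K , z≢x , _) → ∈-delete⁺ z∈K z≢x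
                    ; (inj₂ z∈D , z≢x , z≢-x) → ∈-delete⁺ (absorbed z∈D z≢-x) z≢x }

    Reduct : Clause → Clause → Set
    Reduct K C = (K ≈ᶜ P₂ × C ≈ᶜ Q₂) ⊎ (K ≈ᶜ D × C ≈ᶜ R)
               ⊎ (- x ∉ K × ¬ K ≈ᶜ P₁ × C ≈ᶜ delete x K)

    reduct-preserves : ∀ {K C l} → Reduct K C → l ∈ K → l ≢ x → l ≢ - x → l ∈ C
    reduct-preserves (inj₁ (K≈P₂ , C≈Q₂)) l∈K _ l≢-x = from C≈Q₂ (∈-∷⁻ (to K≈P₂ l∈K) l≢-x)
    reduct-preserves (inj₂ (inj₁ (K≈D , C≈R))) l∈K _ l≢-x = from C≈R (∈-∷⁻ (D⊆x̄∷R (to K≈D l∈K)) l≢-x)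
    reduct-preserves (inj₂ (inj₂ (_ , _ , C≈K∖x))) l∈K l≢x _ = from C≈K∖x (∈-delete⁺ l∈K l≢x)

    reduct-injective : ∀ {K K' C C'} → K ∈ F → K' ∈ F → Reduct K C → Reduct K' C' → C ≈ᶜ C'
                     → K ≈ᶜ K'
    reduct-injective _ _ (inj₁ (K≈P₂ , _)) (inj₁ (K'≈P₂ , _)) _ = ≈ᶜ-trans K≈P₂ (≈ᶜ-sym K'≈P₂)
    reduct-injective _ _ (inj₂ (inj₁ (K≈D , _))) (inj₂ (inj₁ (K'≈D , _))) _ =
      ≈ᶜ-trans K≈D (≈ᶜ-sym K'≈D)
    reduct-injective K∈F K'∈F (inj₂ (inj₂ (_ , _ , C≈K∖x))) (inj₂ (inj₂ (-x∉K' , _ , C'≈K'∖x))) e =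
      delete-injective wf-F hit K∈F K'∈F -x∉K' (≈ᶜ-trans (≈ᶜ-sym C≈K∖x) (≈ᶜ-trans e C'≈K'∖x))
    reduct-injective _ _ (inj₁ (_ , C≈Q₂)) (inj₂ (inj₁ (_ , C'≈R))) e =
      ⊥-elim (Q₂≉R (≈ᶜ-trans (≈ᶜ-sym C≈Q₂) (≈ᶜ-trans e C'≈R)))
    reduct-injective _ _ (inj₂ (inj₁ (_ , C≈R))) (inj₁ (_ , C'≈Q₂)) e =
      ⊥-elim (Q₂≉R (≈ᶜ-trans (≈ᶜ-sym C'≈Q₂) (≈ᶜ-trans (≈ᶜ-sym e) C≈R)))
    reduct-injective _ K'∈F (inj₁ (_ , C≈Q₂)) (inj₂ (inj₂ (-x∉K' , K'≉P₁ , C'≈K'∖x))) e =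
      ⊥-elim (delete≉⊇E K'∈F -x∉K' K'≉P₁ wf-Q₂ there
                (≈ᶜ-trans (≈ᶜ-sym C'≈K'∖x) (≈ᶜ-trans (≈ᶜ-sym e) C≈Q₂)))
    reduct-injective K∈F _ (inj₂ (inj₂ (-x∉K , K≉P₁ , C≈K∖x))) (inj₁ (_ , C'≈Q₂)) e =
      ⊥-elim (delete≉⊇E K∈F -x∉K K≉P₁ wf-Q₂ there (≈ᶜ-trans (≈ᶜ-sym C≈K∖x) (≈ᶜ-trans e C'≈Q₂)))
    reduct-injective _ K'∈F (inj₂ (inj₁ (_ , C≈R))) (inj₂ (inj₂ (-x∉K' , K'≉P₁ , C'≈K'∖x))) e =
      ⊥-elim (delete≉⊇E K'∈F -x∉K' K'≉P₁ wf-R there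
                (≈ᶜ-trans (≈ᶜ-sym C'≈K'∖x) (≈ᶜ-trans (≈ᶜ-sym e) C≈R)))
    reduct-injective K∈F _ (inj₂ (inj₂ (-x∉K , K≉P₁ , C≈K∖x))) (inj₂ (inj₁ (_ , C'≈R))) e =
      ⊥-elim (delete≉⊇E K∈F -x∉K K≉P₁ wf-R there (≈ᶜ-trans (≈ᶜ-sym C≈K∖x) (≈ᶜ-trans e C'≈R)))

    module Reduction (v : ℕ) (x-var : x ≡ + v ⊎ x ≡ - (+ v)) (G : ClauseSet)
                     (G-def : ∀ C → C ∈ᶠ G ⟺ InDP F' v C) where

      G-iff : ∀ C → C ∈ᶠ G ⟺ InDPˡ F' x C
      G-iff C = (λ C∈G → proj₁ (InDP⇔InDPˡ x-var) (proj₁ (G-def C) C∈G))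
              , (λ d → proj₂ (G-def C) (proj₂ (InDP⇔InDPˡ x-var) d))

      resolvent-reduct : ∀ {W C} → W ∈ F' → Resolvent x W D C → ∃[ K ] (K ∈ F × Reduct K C)
      resolvent-reduct W∈F' res with F'-cases W∈F' | Resolvent-pivot res
      ... | inj₁ ((K , K∈F , K≈W) , W≉P₁ , _) | x∈W , _ =
        K , K∈F , inj₂ (inj₂ (-x∉K , K≉P₁ ,
          Resolvent-unique (Resolvent-resp (≈ᶜ-sym K≈W) ≈ᶜ-refl res) (resolvent-delete K∈F x∈K K≉P₁)))
        where
        x∈K = from K≈W x∈W
        -x∉K = proj₂ (wf K∈F) x x∈K
        K≉P₁ = λ K≈P₁ → W≉P₁ (≈ᶜ-trans (≈ᶜ-sym K≈W) K≈P₁)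
      ... | inj₂ (inj₁ W≈Q₁) | _ =
        let (D' , D'∈F , D'≈D) = D∈ᶠF
        in D' , D'∈F , inj₂ (inj₁ (D'≈D , Resolvent-unique (Resolvent-resp W≈Q₁ ≈ᶜ-refl res) resolvent-Q₁))
      ... | inj₂ (inj₂ W≈Q₂) | x∈W , _ = ⊥-elim (x∉Q₂ (to W≈Q₂ x∈W))

      untouched-reduct : ∀ {C} → C ∈ᶠ F' → x ∉ C → - x ∉ C → ∃[ K ] (K ∈ F × Reduct K C)
      untouched-reduct (C' , C'∈F' , C'≈C) x∉C -x∉C with F'-cases C'∈F'
      ... | inj₁ ((K , K∈F , K≈C') , _) =
        K , K∈F , inj₂ (inj₂ ((λ m → -x∉C (to K≈C m)) , (λ K≈P₁ → x∉C (to K≈C (from K≈P₁ (here refl))))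
                , ≈ᶜ-trans (≈ᶜ-sym K≈C) (≈ᶜ-sym (delete-absent (λ m → x∉C (to K≈C m))))))
        where K≈C = ≈ᶜ-trans K≈C' C'≈C
      ... | inj₂ (inj₁ C'≈Q₁) = ⊥-elim (x∉C (to C'≈C (from C'≈Q₁ (here refl))))
      ... | inj₂ (inj₂ C'≈Q₂) =
        let (P₂' , P₂'∈F , P₂'≈P₂) = P₂∈F in P₂' , P₂'∈F , inj₁ (P₂'≈P₂ , ≈ᶜ-trans (≈ᶜ-sym C'≈C) C'≈Q₂)

      G-reduct : ∀ {C} → C ∈ᶠ G → ∃[ K ] (K ∈ F × Reduct K C)
      G-reduct {C} C∈G with proj₁ (G-iff C) C∈G
      ... | inj₁ (W , B , W∈F' , B∈F' , res) =
        resolvent-reduct W∈F' (Resolvent-resp ≈ᶜ-refl (D-unique B B∈F' (proj₂ (Resolvent-pivot res))) res)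
      ... | inj₂ (C∈F' , x∉C , -x∉C) = untouched-reduct C∈F' x∉C -x∉C

      Q₂∈G : Q₂ ∈ᶠ G
      Q₂∈G = proj₂ (G-iff Q₂) (inj₂ (Q₂∈F' , x∉Q₂ , -x∉Q₂))

      R∈G : R ∈ᶠ G
      R∈G = let (Q₁' , Q₁'∈F' , Q₁'≈Q₁) = Q₁∈F' in
        proj₂ (G-iff R) (inj₁ (Q₁' , D , Q₁'∈F' , D∈F' , Resolvent-resp (≈ᶜ-sym Q₁'≈Q₁) ≈ᶜ-refl resolvent-Q₁))

      delete∈G : ∀ {K} → K ∈ F → - x ∉ K → ¬ K ≈ᶜ P₁ → delete x K ∈ᶠ G
      delete∈G {K} K∈F -x∉K K≉P₁ with F'-keeps K∈F K≉P₁ (λ K≈P₂ → -x∉K (from K≈P₂ (here refl))) | x ∈? K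
      ... | K' , K'∈F' , K'≈K | yes x∈K = proj₂ (G-iff _)
        (inj₁ (K' , D , K'∈F' , D∈F' , Resolvent-resp (≈ᶜ-sym K'≈K) ≈ᶜ-refl (resolvent-delete K∈F x∈K K≉P₁)))
      ... | K∈F' | no x∉K = proj₂ (G-iff _)
        (inj₂ (∈ᶠ-resp-≈ᶜ (≈ᶜ-sym (delete-absent x∉K)) K∈F'
              , (λ m → proj₂ (∈-delete⁻ {C = K} m) refl) , (λ m → -x∉K (proj₁ (∈-delete⁻ {C = K} m)))))

      reduct-exists : ∀ {K} → K ∈ F → ¬ K ≈ᶜ P₁ → ∃[ C ] (C ∈ᶠ G × Reduct K C)
      reduct-exists {K} K∈F K≉P₁ with - x ∈? K
      ... | no -x∉K = delete x K , delete∈G K∈F -x∉K K≉P₁ , inj₂ (inj₂ (-x∉K , K≉P₁ , ≈ᶜ-refl))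
      ... | yes -x∈K with x̄-clauses K∈F -x∈K
      ...   | inj₁ K≈P₂ = Q₂ , Q₂∈G , inj₁ (K≈P₂ , ≈ᶜ-refl)
      ...   | inj₂ K≈D = R , R∈G , inj₂ (inj₁ (K≈D , ≈ᶜ-refl))

      ±x∉G : ∀ {C} → C ∈ᶠ G → x ∉ C × - x ∉ C
      ±x∉G {C} C∈G = InDPˡ-free (proj₁ (G-iff C) C∈G)

      Occurs-G⇒F : ∀ {l} → Occurs l G → Occurs l F
      Occurs-G⇒F {l} (C , C∈G , l∈C) with G-reduct (C , C∈G , ≈ᶜ-refl)
      ... | K , K∈F , inj₁ (K≈P₂ , C≈Q₂) = occurs-∈ᶠ (K , K∈F , K≈P₂) (there (to C≈Q₂ l∈C))
      ... | K , K∈F , inj₂ (inj₂ (_ , _ , C≈K∖x)) = K , K∈F , proj₁ (∈-delete⁻ (to C≈K∖x l∈C))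
      ... | K , K∈F , inj₂ (inj₁ (_ , C≈R)) with to C≈R l∈C
      ...   | here refl = -y-occurs
      ...   | there l∈E = occurs-∈ᶠ P₁∈F (there l∈E)

      LDegOne-G⇒F : ∀ {l} → LDegOne l G → LDegOne l F
      LDegOne-G⇒F {l} ld@(C , C∈G , l∈C , _) with l ≟ x | l ≟ - x | l ∈? E
      ... | yes refl | _ | _ = ⊥-elim (proj₁ (±x∉G (C , C∈G , ≈ᶜ-refl)) l∈C)
      ... | no _ | yes refl | _ = ⊥-elim (proj₂ (±x∉G (C , C∈G , ≈ᶜ-refl)) l∈C)
      ... | no _ | no _ | yes l∈E = ⊥-elim (Q₂≉R (LDegOne-unique ld Q₂∈G R∈G (there l∈E) (there l∈E)))
      ... | no l≢x | no l≢-x | no l∉E =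
        LDegOne-reflect Reduct image reduct-injective (Occurs-G⇒F (C , C∈G , l∈C)) ld
        where
        image : ∀ {K} → K ∈ F → l ∈ K → ∃[ C' ] (C' ∈ᶠ G × l ∈ C' × Reduct K C')
        image K∈F l∈K =
          let (C' , C'∈G , r) = reduct-exists K∈F (λ K≈P₁ → ∉-∷ l≢x l∉E (to K≈P₁ l∈K))
          in C' , C'∈G , reduct-preserves r l∈K l≢x l≢-x , r

      nonsingular-G : Nonsingular G
      nonsingular-G = Nonsingular-reflect Occurs-G⇒F LDegOne-G⇒F nonsing

      E∉G : ¬ E ∈ᶠ G
      E∉G E∈G with G-reduct E∈G
      ... | _ , _ , inj₁ (_ , E≈Q₂) = y∉E (from E≈Q₂ (here refl))
      ... | _ , _ , inj₂ (inj₁ (_ , E≈R)) = -y∉E (from E≈R (here refl))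
      ... | K , K∈F , inj₂ (inj₂ (-x∉K , K≉P₁ , E≈K∖x)) =
        delete≉⊇E K∈F -x∉K K≉P₁ wf-E (λ m → m) (≈ᶜ-sym E≈K∖x)

      wf-G : ∀ {C} → C ∈ᶠ G → WFClause C
      wf-G C∈G with G-reduct C∈G
      ... | _ , _ , inj₁ (_ , C≈Q₂) = WFClause-resp (≈ᶜ-sym C≈Q₂) wf-Q₂
      ... | _ , _ , inj₂ (inj₁ (_ , C≈R)) = WFClause-resp (≈ᶜ-sym C≈R) wf-R
      ... | K , K∈F , inj₂ (inj₂ (_ , _ , C≈K∖x)) =
        WFClause-resp (≈ᶜ-sym C≈K∖x) (WFClause-⊆ (λ m → proj₁ (∈-delete⁻ m)) (wf K∈F))

      not-Q₂-R? : (C : Clause) → Dec (¬ C ≈ᶜ Q₂ × ¬ C ≈ᶜ R)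
      not-Q₂-R? C = ¬? (C ≈ᶜ? Q₂) ×-dec ¬? (C ≈ᶜ? R)

      not-Q₂-R⁻ : ∀ {C} → C ∈ filter not-Q₂-R? G → C ∈ G × ¬ C ≈ᶜ Q₂ × ¬ C ≈ᶜ R
      not-Q₂-R⁻ = ∈-filter⁻ not-Q₂-R? {xs = G}

      G₀ H : ClauseSet
      G₀ = E ∷ filter not-Q₂-R? G
      H = [ y ] ∷ [ - y ] ∷ []

      y∈G₀ : ∃[ C ] (C ∈ filter not-Q₂-R? G × y ∈ C)
      y∈G₀ = let (P₂' , P₂'∈F , P₂'≈P₂) = P₂∈F in avoiding P₂'∈F P₂'≈P₂
        where
        y≢x : y ≢ x
        y≢x p = x≢y (sym p)
        avoiding : ∀ {P₂'} → P₂' ∈ F → P₂' ≈ᶜ P₂ → ∃[ C ] (C ∈ filter not-Q₂-R? G × y ∈ C)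
        avoiding {P₂'} P₂'∈F P₂'≈P₂
          with another-occurrence nonsing y≢0 -y-occurs P₂'∈F (from P₂'≈P₂ (there (here refl)))
        ... | K , K∈F , y∈K , K≉P₂' with reduct-exists K∈F (λ K≈P₁ → ∉-∷ y≢x y∉E (to K≈P₁ y∈K))
        ...   | C , (C' , C'∈G , C'≈C) , r = C' , ∈-filter⁺ not-Q₂-R? C'∈G (C'≉Q₂ , C'≉R) , y∈C'
          where
          y∈C' = from C'≈C (reduct-preserves r y∈K y≢x (λ p → -x≢y (sym p)))
          C'≉Q₂ : ¬ C' ≈ᶜ Q₂
          C'≉Q₂ C'≈Q₂ = K≉P₂' (reduct-injective K∈F P₂'∈F r (inj₁ (P₂'≈P₂ , ≈ᶜ-refl))
                                  (≈ᶜ-trans (≈ᶜ-sym C'≈C) C'≈Q₂))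
          C'≉R : ¬ C' ≈ᶜ R
          C'≉R C'≈R = ∉-∷ (≢-neg-self y≢0) y∉E (to C'≈R y∈C')

      wf-H : WFClauseSet H
      wf-H = WFClause-∷ y≢0 (λ ()) wf-[] ∷ WFClause-∷ (λ p → y≢0 (neg-swap p)) (λ ()) wf-[] ∷ []
        where
        wf-[] : WFClause []
        wf-[] = (λ _ ()) , (λ _ ())

      unsat-H : Unsatisfiable H
      unsat-H (T , (_ , consistent) , (_ , y∈T , here refl) ∷ (_ , -y∈T , here refl) ∷ []) =
        consistent y y∈T -y∈T

      var-E∩var-H : ∀ w → VarC w E → VarF w H → ⊥
      var-E∩var-H w w∈E (_ , here refl , w∈y) = VarC-[]-disjoint y∉E -y∉E w∈y w∈E
      var-E∩var-H w w∈E (_ , there (here refl) , w∈ȳ) =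
        VarC-[]-disjoint -y∉E (λ m → y∉E (subst (_∈ E) (neg-involutive y) m)) w∈ȳ w∈E

      G₀-new-disjoint : ∀ C → (C ∈ᶠ G₀ × ¬ C ≈ᶜ E) → NewPart E H C → ⊥
      G₀-new-disjoint C ((_ , here refl , E≈C) , C≉E) _ = C≉E (≈ᶜ-sym E≈C)
      G₀-new-disjoint C ((K , there K∈G′ , K≈C) , _) (_ , here refl , _ , C≈E∪y) =
        proj₁ (proj₂ (not-Q₂-R⁻ K∈G′))
          (≈ᶜ-trans K≈C (≈ᶜ-trans C≈E∪y (≈ᶜ-sym (∷-≈ᶜ-++ y E))))
      G₀-new-disjoint C ((K , there K∈G′ , K≈C) , _) (_ , there (here refl) , _ , C≈E∪ȳ) =
        proj₂ (proj₂ (not-Q₂-R⁻ K∈G′))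
          (≈ᶜ-trans K≈C (≈ᶜ-trans C≈E∪ȳ (≈ᶜ-sym (∷-≈ᶜ-++ (- y) E))))

      G≈◇ : ∀ C → C ∈ᶠ G ⟺ InDiamond G₀ E H C
      G≈◇ C = into , out
        where
        E∩y : ∀ z → z ∈ E → - z ∈ [ y ] → ⊥
        E∩y z z∈E (here -z≡y) = -y∉E (subst (_∈ E) (neg-swap -z≡y) z∈E)
        E∩ȳ : ∀ z → z ∈ E → - z ∈ [ - y ] → ⊥
        E∩ȳ z z∈E (here -z≡-y) = y∉E (subst (_∈ E) (neg-injective -z≡-y) z∈E)
        into : C ∈ᶠ G → InDiamond G₀ E H C
        into (K , K∈G , K≈C) with K ≈ᶜ? Q₂ | K ≈ᶜ? R
        ... | yes K≈Q₂ | _ =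
          inj₂ ([ y ] , here refl , E∩y , ≈ᶜ-trans (≈ᶜ-sym K≈C) (≈ᶜ-trans K≈Q₂ (∷-≈ᶜ-++ y E)))
        ... | no _ | yes K≈R =
          inj₂ ([ - y ] , there (here refl) , E∩ȳ , ≈ᶜ-trans (≈ᶜ-sym K≈C) (≈ᶜ-trans K≈R (∷-≈ᶜ-++ (- y) E)))
        ... | no K≉Q₂ | no K≉R =
          inj₁ ((K , there (∈-filter⁺ not-Q₂-R? K∈G (K≉Q₂ , K≉R)) , K≈C)
               , λ C≈E → E∉G (∈ᶠ-resp-≈ᶜ C≈E (K , K∈G , K≈C)))
        out : InDiamond G₀ E H C → C ∈ᶠ G
        out (inj₁ ((_ , here refl , E≈C) , C≉E)) = ⊥-elim (C≉E (≈ᶜ-sym E≈C))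
        out (inj₁ ((K , there K∈G′ , K≈C) , _)) = K , proj₁ (not-Q₂-R⁻ K∈G′) , K≈C
        out (inj₂ (_ , here refl , _ , C≈E∪y)) =
          ∈ᶠ-resp-≈ᶜ (≈ᶜ-sym (≈ᶜ-trans C≈E∪y (≈ᶜ-sym (∷-≈ᶜ-++ y E)))) Q₂∈G
        out (inj₂ (_ , there (here refl) , _ , C≈E∪ȳ)) =
          ∈ᶠ-resp-≈ᶜ (≈ᶜ-sym (≈ᶜ-trans C≈E∪ȳ (≈ᶜ-sym (∷-≈ᶜ-++ (- y) E)))) R∈G

      factorisation : ∃[ G₀ ] ∃[ C ] ∃[ H ]
                        (NontrivialFactorisation G G₀ C H × ∃[ w ] (VarF w G₀ × VarF w H))
      factorisation with y∈G₀ | literal-of-var y y≢0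
      ... | K , K∈G′ , y∈K | w , var-y =
        G₀ , E , H
        , ( wf-E ∷ All.tabulate (λ K∈G′ → wf-G (_ , proj₁ (not-Q₂-R⁻ K∈G′) , ≈ᶜ-refl))
          , wf-H , here refl , var-E∩var-H , G₀-new-disjoint , unsat-H
          , ≉-[[]] (there K∈G′) y∈K , ≉-[[]] (here refl) (here refl) , G≈◇ )
        , w , (K , there K∈G′ , var-y K y∈K) , ([ y ] , here refl , var-y [ y ] (here refl))

lemma23 : (F F' : ClauseSet)
    → WFClauseSet F → Unsatisfiable F → Hitting F → Nonsingular F
    → NfsFlip F F'
    → ((n : ℕ) (G : ClauseSet) → SReach F' n G → Nonsingular G → n ≤ 1)
      × (¬ FsResolvable F → (G : ClauseSet) → SReach F' 1 G → Nonsingular G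
          → ∃[ G₀ ] ∃[ C ] ∃[ H ]
              (NontrivialFactorisation G G₀ C H
               × ∃[ v ] (VarF v G₀ × VarF v H)))
lemma23 F F' wf-F unsat hit nonsing
  (E , x , y , wf-E , x≢0 , y≢0 , x≢y , x≢-y , x∉E , -x∉E , y∉E , -y∉E , P₁∈F , P₂∈F , Q₁∉F , Q₂∉F , F'-def) =
  at-most-one , factorised
  where
  open Flip wf-F unsat hit nonsing E x y wf-E x≢0 y≢0 x≢y x≢-y x∉E -x∉E y∉E -y∉E
            P₁∈F P₂∈F Q₁∉F Q₂∉F F'-def

  at-most-one : (n : ℕ) (G : ClauseSet) → SReach F' n G → Nonsingular G → n ≤ 1
  at-most-one _ _ done _ = z≤n
  at-most-one _ _ (step _ _ done) _ = s≤s z≤n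
  at-most-one _ _ (step v (singular , F₁-def) (step w (singular₁ , _) _)) _
    with singular-F' singular
  ... | x-var , D , D∈F' , -x∈D , D-unique =
    ⊥-elim (Pivot.Reduction.nonsingular-G D D∈F' -x∈D D-unique v x-var _ F₁-def w singular₁)

  factorised : ¬ FsResolvable F → (G : ClauseSet) → SReach F' 1 G → Nonsingular G
             → ∃[ G₀ ] ∃[ C ] ∃[ H ] (NontrivialFactorisation G G₀ C H × ∃[ v ] (VarF v G₀ × VarF v H))
  factorised _ G (step v (singular , G-def) done) _ with singular-F' singular
  ... | x-var , D , D∈F' , -x∈D , D-unique =
    Pivot.Reduction.factorisation D D∈F' -x∈D D-unique v x-var G G-def
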